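{- Let $H$ be a ribbon hypermap and $A\subseteq E(H)$, $A^c=E(H)\setminus A$. Then $$\varepsilon(H^{A})=\varepsilon(A)+\varepsilon(A^{c})+2\bigl(k(H)-k(A)-k(A^{c})\bigr)+2v(H).$$
   Context: A ribbon hypermap $H$ is a (possibly non-orientable) surface with boundary, written as the union of two sets of discs, the hypervertices $V(H)$ and the hyperedges $E(H)$, such that hypervertices and hyperedges meet in disjoint line segments (common line segments), each lying on the boundary of exactly one hypervertex and exactly one hyperedge. Hyperfaces are the boundary components of the surface. $v(H),e(H),f(H),k(H)$ are the numbers of hypervertices, hyperedges, hyperfaces and connected components; $d(e)$ is the number of common line segments on hyperedge $e$ and $d(H)=\sum_e d(e)$. The Euler genus is $\varepsilon(H)=2k(H)+d(H)-v(H)-e(H)-f(H)$. For $A\subseteq E(H)$, $A$ also denotes the sub-ribbon hypermap obtained from $H$ by deleting all hyperedges not in $A$ but keeping all hypervertices (even isolated ones). Partial dual $H^A$: in an arrow presentation of $H$ (hypervertices as closed curves; each hyperedge $e$ as arrows $e_1,\dots,e_{d(e)}$ along its common line segments in cyclic order around $e$), for each $e\in A$ and each $i$ draw a new arrow from the head of $e_i$ to the tail of $e_{i+1}$ (indices mod $d(e)$), label it $e_i$, and delete the original arrows; the new arrows become arcs of the closed curves of the arrow presentation of $H^A$ (equivalently, the hypervertices of $H^A$ are the boundary components of the sub-ribbon hypermap $A$, and the hyperedges are unchanged). -}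

module Defs where

open import Data.Bool using (Bool; true; false; _∧_; _∨_; not; if_then_else_)
open import Data.Nat using (ℕ; zero; suc; _+_; _*_; ⌊_/2⌋)
open import Data.Fin using (Fin; _<?_)
open import Data.Fin.Properties using (_≟_)
open import Data.List using (List; []; _∷_; allFin; map)
open import Data.Bool.ListAction using (any)
open import Data.Nat.ListAction using (sum)
open import Data.Integer as ℤ using (ℤ; +_)
open import Relation.Nullary.Decidable using (⌊_⌋)
open import Relation.Binary.PropositionalEquality using (_≡_; _≢_; cong)

countTrue : {n : ℕ} → (Fin n → Bool) → ℕ
countTrue {n} P = sum (map (λ x → if P x then 1 else 0) (allFin n))

img : {n : ℕ} → (Fin n → Fin n) → (Fin n → Bool) → Fin n → Bool
img {n} g P y = any (λ x → P x ∧ ⌊ g x ≟ y ⌋) (allFin n)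

step : {n : ℕ} → List (Fin n → Fin n) → (Fin n → Bool) → Fin n → Bool
step gs P y = P y ∨ any (λ g → img g P y) gs

iterStep : {n : ℕ} → ℕ → List (Fin n → Fin n) → (Fin n → Bool) → Fin n → Bool
iterStep zero    gs P = P
iterStep (suc k) gs P = step gs (iterStep k gs P)

-- orbit gs x y : y lies in the orbit of x under the group generated by gs
-- (n closure steps suffice on a set of size n; generators are bijections)
orbit : {n : ℕ} → List (Fin n → Fin n) → Fin n → Fin n → Bool
orbit {n} gs x = iterStep n gs (λ y → ⌊ y ≟ x ⌋)

-- number of orbits of ⟨gs⟩ contained in the (gs-invariant) set S:
-- count elements of S that are the least element of their orbit
countOrbits : {n : ℕ} → (Fin n → Bool) → List (Fin n → Fin n) → ℕ
countOrbits {n} S gs =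
  countTrue (λ x → S x ∧ not (any (λ y → ⌊ y <? x ⌋ ∧ orbit gs x y) (allFin n)))

-- Flags = the endpoints of the common line segments (2 per segment).
--   t  : swaps the two endpoints of the same common line segment
--   aV : pairs an endpoint with the next segment endpoint along the
--        boundary of its hypervertex (through a non-segment boundary arc)
--   aE : same along the boundary of its hyperedge
-- hypervertices = ⟨t,aV⟩-orbits, hyperedges = ⟨t,aE⟩-orbits,
-- hyperfaces (boundary components) = ⟨aV,aE⟩-orbits,
-- components = ⟨t,aV,aE⟩-orbits.
-- Discs without any common line segment (isolated hypervertices /
-- hyperedges) are not seen by flags and are counted separately.

record RibbonHypermap : Set where
  field
    n     : ℕ
    t aV aE : Fin n → Fin n
    t-invol  : ∀ x → t (t x) ≡ x
    aV-invol : ∀ x → aV (aV x) ≡ x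
    aE-invol : ∀ x → aE (aE x) ≡ x
    t-fpf    : ∀ x → t x ≢ x
    aV-fpf   : ∀ x → aV x ≢ x
    aE-fpf   : ∀ x → aE x ≢ x
    isoV  : ℕ      -- hypervertices with no common line segment
    isoE  : ℕ      -- hyperedges with no common line segment
open RibbonHypermap public

-- A subset A ⊆ E(H): a set of flags which is a union of hyperedge
-- orbits (closed under t and aE), plus a choice of isolated hyperedges.
record EdgeSubset (H : RibbonHypermap) : Set where
  field
    inA    : Fin (n H) → Bool
    inA-t  : ∀ x → inA (t H x) ≡ inA x
    inA-aE : ∀ x → inA (aE H x) ≡ inA x
    isoA   : Fin (isoE H) → Bool
open EdgeSubset public

complement : {H : RibbonHypermap} → EdgeSubset H → EdgeSubset H
complement {H} A = record
  { inA    = λ x → not (inA A x)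
  ; inA-t  = λ x → cong not (inA-t A x)
  ; inA-aE = λ x → cong not (inA-aE A x)
  ; isoA   = λ i → not (isoA A i) }

-- Combinatorial data from which the parameters are read off:
-- a set `live` of flags (the flags actually present), involutions on it,
-- and the numbers of isolated hypervertices / hyperedges.

record HData : Set where
  field
    m      : ℕ
    live   : Fin m → Bool
    τ ρV ρE : Fin m → Fin m
    nIsoV nIsoE : ℕ

module _ (D : HData) where
  open HData D
  vD eD fD kD dD : ℕ
  vD = countOrbits live (τ ∷ ρV ∷ []) + nIsoV
  eD = countOrbits live (τ ∷ ρE ∷ []) + nIsoE
  fD = countOrbits live (ρV ∷ ρE ∷ []) + nIsoV + nIsoE
  kD = countOrbits live (τ ∷ ρV ∷ ρE ∷ []) + nIsoV + nIsoE
  dD = ⌊ countTrue live /2⌋        -- number of common line segments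

  εD : ℤ
  εD = (+ (2 * kD + dD)) ℤ.- (+ (vD + eD + fD))

asData : RibbonHypermap → HData
asData H = record { m = n H ; live = λ _ → true ; τ = t H ; ρV = aV H ; ρE = aE H
                  ; nIsoV = isoV H ; nIsoE = isoE H }

v e f k d : RibbonHypermap → ℕ
v H = vD (asData H)
e H = eD (asData H)
f H = fD (asData H)
k H = kD (asData H)
d H = dD (asData H)

ε : RibbonHypermap → ℤ
ε H = εD (asData H)

-- Sub-ribbon hypermap A: delete the hyperedges not in A, keep all
-- hypervertices.  Along a hypervertex boundary
-- the next A-flag after x is found by walking aV, and crossing each deleted
-- segment (via t) until an A-flag is reached.

skipTo : {N : ℕ} → (Fin N → Bool) → (Fin N → Fin N) → ℕ → Fin N → Fin N
skipTo S g zero    y = y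
skipTo S g (suc j) y = if S y then y else skipTo S g j (g y)

subData : (H : RibbonHypermap) → EdgeSubset H → HData
subData H A = record
  { m     = n H
  ; live  = inA A
  ; τ     = t H
  ; ρV    = λ x → skipTo (inA A) (λ y → aV H (t H y)) (n H) (aV H x)
  ; ρE    = aE H
  -- isolated hypervertices of A: those of H, plus hypervertices of H
  -- none of whose segments lies on a hyperedge of A
  ; nIsoV = isoV H + countOrbits
              (λ x → not (any (λ y → orbit (t H ∷ aV H ∷ []) x y ∧ inA A y)
                              (allFin (n H))))
              (t H ∷ aV H ∷ [])
  ; nIsoE = countTrue (isoA A) }

εSub : (H : RibbonHypermap) → EdgeSubset H → ℤ
εSub H A = εD (subData H A)

kSub : (H : RibbonHypermap) → EdgeSubset H → ℕ
kSub H A = kD (subData H A)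

-- On the flags of hyperedges in A, the roles of t
-- and aE are exchanged (new segment e_i runs from the head of e_i to the
-- tail of e_{i+1} along the boundary of e, i.e. is an aE-pair); the new
-- hypervertices are the ⟨t',aV⟩-orbits = boundary components of A;
-- hyperedges are unchanged.

partialDual : (H : RibbonHypermap) → EdgeSubset H → RibbonHypermap
partialDual H A = record
  { n = n H
  ; t  = t'
  ; aV = aV H
  ; aE = aE'
  ; t-invol  = t'-invol
  ; aV-invol = aV-invol H
  ; aE-invol = aE'-invol
  ; t-fpf    = t'-fpf
  ; aV-fpf   = aV-fpf H
  ; aE-fpf   = aE'-fpf
  ; isoV = isoV H
  ; isoE = isoE H }
  where
  t' aE' : Fin (n H) → Fin (n H)
  t'  x = if inA A x then aE H x else t H x
  aE' x = if inA A x then t H x else aE H x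

  t'-invol : ∀ x → t' (t' x) ≡ x
  t'-invol x with inA A x in eq
  ... | true  rewrite inA-aE A x | eq = aE-invol H x
  ... | false rewrite inA-t A x | eq = t-invol H x

  aE'-invol : ∀ x → aE' (aE' x) ≡ x
  aE'-invol x with inA A x in eq
  ... | true  rewrite inA-t A x | eq = t-invol H x
  ... | false rewrite inA-aE A x | eq = aE-invol H x

  t'-fpf : ∀ x → t' x ≢ x
  t'-fpf x with inA A x
  ... | true  = aE-fpf H x
  ... | false = t-fpf H x

  aE'-fpf : ∀ x → aE' x ≢ x
  aE'-fpf x with inA A x
  ... | true  = t-fpf H x
  ... | false = aE-fpf H x

module Submission where

-- The hypervertices of H^A are the ⟨t′,aV⟩-orbits of flags, where t′ is aE on the flags of A
-- and t elsewhere.  Walking along such an orbit and recording only the flags of A traces a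
-- boundary component of the sub-hypermap A (through the first-return map ρ), while an orbit
-- without flags of A is a hypervertex of H meeting no hyperedge of A; hence
-- v(H^A) + (isolated hyperedges of A) = f(A).  The faces of H^A are the hypervertices of
-- H^(A^c), so f(H^A) = f(A^c) + (isolated hyperedges of A), and the same argument with t′ = t
-- gives v(A) = v(A^c) = v(H).  Partial duality keeps k, while e and d split between A and A^c;
-- substituting into ε = 2k + d − v − e − f gives the identity.  Orbits are counted through
-- their least flags, and an orbit is matched with its trace on A by double counting.

open import Defs
open import Data.Integer using (ℤ; +_; _+_; _-_; _*_)
open import Relation.Binary.PropositionalEquality using (_≡_)

open import Data.Bool using (Bool; true; false; T; _∧_; not; if_then_else_)
open import Data.Bool.ListAction using (any; or)
open import Data.Bool.Properties using (T-∧; T-∨; ∧-zeroʳ; ∧-identityʳ; ∧-comm; if-not)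
open import Data.Empty using (⊥-elim)
open import Data.Fin as Fin using (Fin; zero; suc; _<?_)
open import Data.Fin.Properties using (_≟_)
import Data.Fin.Properties as Finₚ
open import Data.Integer.Properties using (pos-*)
import Data.Integer.Tactic.RingSolver as ℤ-Solver
open import Data.List using (List; []; _∷_; allFin; tabulate)
open import Data.List.Membership.Propositional using (_∈_; find; lose)
open import Data.List.Membership.Propositional.Properties using (∈-allFin)
open import Data.List.Properties using (map-tabulate; map-cong)
open import Data.List.Relation.Unary.All as All using (All; []; _∷_)
open import Data.List.Relation.Unary.Any using (here; there)
open import Data.List.Relation.Unary.Any.Properties using (any⁺; any⁻)
open import Data.Nat as ℕ using (ℕ; zero; suc; z≤n; s≤s; ⌊_/2⌋)
open import Data.Nat.GeneralisedArithmetic using (iterate)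
import Data.Nat.ListAction as ListAction
import Data.Nat.Properties as ℕₚ
import Data.Nat.Tactic.RingSolver as ℕ-Solver
open import Algebra.Properties.CommutativeMonoid.Sum ℕₚ.+-0-commutativeMonoid
  using (sum; sum-cong-≗; ∑-distrib-+; ∑-comm)
open import Data.Product using (∃-syntax; _×_; _,_; proj₁; proj₂)
open import Data.Sum using (_⊎_; inj₁; inj₂)
open import Function using (_∘_; id; Equivalence)
open import Relation.Binary.Definitions using (tri<; tri≈; tri>)
open import Relation.Binary.PropositionalEquality
  using (refl; sym; trans; cong; cong₂; subst; _≢_; _≗_; module ≡-Reasoning)
open import Relation.Binary.Structures using (IsEquivalence)
open import Relation.Nullary using (¬_; yes; no)
open import Relation.Nullary.Decidable using (⌊_⌋; toWitness; fromWitness; T?; decidable-stable)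

private
  variable
    m : ℕ

T-ext : ∀ {a b} → (T a → T b) → (T b → T a) → a ≡ b
T-ext {false} {false} _ _ = refl
T-ext {false} {true}  _ g = ⊥-elim (g _)
T-ext {true}  {false} f _ = ⊥-elim (f _)
T-ext {true}  {true}  _ _ = refl

T-∧-intro : ∀ {a b} → T a → T b → T (a ∧ b)
T-∧-intro p q = Equivalence.from T-∧ (p , q)

T-∧-elim : ∀ {a b} → T (a ∧ b) → T a × T b
T-∧-elim = Equivalence.to T-∧

T-not⇒¬T : ∀ {a} → T (not a) → ¬ T a
T-not⇒¬T {true} () _

¬T⇒T-not : ∀ {a} → ¬ T a → T (not a)
¬T⇒T-not {false} _ = _
¬T⇒T-not {true} ¬a = ¬a _

if-T : ∀ {A : Set} {b} {x y : A} → T b → (if b then x else y) ≡ x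
if-T {b = true} _ = refl

if-¬T : ∀ {A : Set} {b} {x y : A} → ¬ T b → (if b then x else y) ≡ y
if-¬T {b = false} _  = refl
if-¬T {b = true}  ¬b = ⊥-elim (¬b _)

count : (Fin m → Bool) → ℕ
count P = sum (λ x → if P x then 1 else 0)

countTrue≡count : (P : Fin m → Bool) → countTrue P ≡ count P
countTrue≡count P = trans (cong ListAction.sum (map-tabulate id indicator)) (sum-tabulate indicator)
  where
  indicator : Fin _ → ℕ
  indicator x = if P x then 1 else 0
  sum-tabulate : ∀ {m} (f : Fin m → ℕ) → ListAction.sum (tabulate f) ≡ sum f
  sum-tabulate {zero}  f = refl
  sum-tabulate {suc m} f = cong (f zero ℕ.+_) (sum-tabulate (f ∘ suc))

count-cong : {P Q : Fin m → Bool} → P ≗ Q → count P ≡ count Q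
count-cong P≗Q = sum-cong-≗ (cong (if_then 1 else 0) ∘ P≗Q)

count-split : (P h : Fin m → Bool) →
  count P ≡ count (λ x → P x ∧ h x) ℕ.+ count (λ x → P x ∧ not (h x))
count-split {m} P h = trans (sum-cong-≗ (λ x → split (P x) (h x))) (∑-distrib-+ {m} _ _)
  where
  split : ∀ a b → (if a then 1 else 0) ≡ (if a ∧ b then 1 else 0) ℕ.+ (if a ∧ not b then 1 else 0)
  split false _     = refl
  split true  false = refl
  split true  true  = refl

count-none : (P : Fin m → Bool) → (∀ x → ¬ T (P x)) → count P ≡ 0
count-none {zero}  P none = refl
count-none {suc m} P none with P zero | none zero
... | false | _  = count-none (P ∘ suc) (none ∘ suc)
... | true  | ¬⊤ = ⊥-elim (¬⊤ _)

count-all : ∀ m → count {m} (λ _ → true) ≡ m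
count-all zero    = refl
count-all (suc m) = cong suc (count-all m)

count-≤ : (P : Fin m → Bool) → count P ℕ.≤ m
count-≤ {zero}  P = z≤n
count-≤ {suc m} P with P zero
... | true  = s≤s (count-≤ (P ∘ suc))
... | false = ℕₚ.m≤n⇒m≤1+n (count-≤ (P ∘ suc))

count-mono : (P Q : Fin m → Bool) → (∀ x → T (P x) → T (Q x)) → count P ℕ.≤ count Q
count-mono {zero}  P Q P⊆Q = z≤n
count-mono {suc m} P Q P⊆Q =
  ℕₚ.+-mono-≤ (head (P zero) (Q zero) (P⊆Q zero)) (count-mono (P ∘ suc) (Q ∘ suc) (P⊆Q ∘ suc))
  where
  head : ∀ a b → (T a → T b) → (if a then 1 else 0) ℕ.≤ (if b then 1 else 0)
  head false _     _   = z≤n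
  head true  true  _   = ℕₚ.≤-refl
  head true  false a⊆b = ⊥-elim (a⊆b _)

count-mono-< : (P Q : Fin m → Bool) → (∀ x → T (P x) → T (Q x)) →
  ∀ y → T (Q y) → ¬ T (P y) → count P ℕ.< count Q
count-mono-< {suc m} P Q P⊆Q zero    Qy ¬Py with P zero | Q zero
... | true  | _    = ⊥-elim (¬Py _)
... | false | true = s≤s (count-mono (P ∘ suc) (Q ∘ suc) (P⊆Q ∘ suc))
count-mono-< {suc m} P Q P⊆Q (suc y) Qy ¬Py
  with P zero | Q zero | P⊆Q zero | count-mono-< (P ∘ suc) (Q ∘ suc) (P⊆Q ∘ suc) y Qy ¬Py
... | false | false | _    | tail< = tail<
... | false | true  | _    | tail< = ℕₚ.m≤n⇒m≤1+n tail<
... | true  | true  | _    | tail< = s≤s tail<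
... | true  | false | P⊆Q₀ | _     = ⊥-elim (P⊆Q₀ _)

count-pos : (P : Fin m → Bool) (y : Fin m) → T (P y) → 0 ℕ.< count P
count-pos {m} P y Py =
  subst (ℕ._< count P) (count-none {m} (λ _ → false) λ _ ()) (count-mono-< _ P (λ _ ()) y Py id)

count-unique : (P : Fin m → Bool) (y : Fin m) → T (P y) → (∀ z → T (P z) → z ≡ y) →
  count P ≡ 1
count-unique {suc m} P zero Py uniq with P zero
... | true  = cong suc (count-none (P ∘ suc) λ z Pz → Finₚ.0≢1+n (sym (uniq (suc z) Pz)))
... | false = ⊥-elim Py
count-unique {suc m} P (suc y) Py uniq with P zero | uniq zero
... | true  | uniq₀ = ⊥-elim (Finₚ.0≢1+n (uniq₀ _))
... | false | _     = count-unique (P ∘ suc) y Py (λ z Pz → Finₚ.suc-injective (uniq (suc z) Pz))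

count-perfect-matching : (R : Fin m → Fin m → Bool) (P Q : Fin m → Bool) →
  (∀ x → T (P x) → count (λ y → Q y ∧ R x y) ≡ 1) →
  (∀ y → T (Q y) → count (λ x → P x ∧ R x y) ≡ 1) →
  count P ≡ count Q
count-perfect-matching {m} R P Q P⇒one Q⇒one = begin
  count P                                                    ≡⟨ sum-cong-≗ row ⟩
  sum (λ x → sum (λ y → if P x ∧ (Q y ∧ R x y) then 1 else 0)) ≡⟨ ∑-comm {m} {m} _ ⟩
  sum (λ y → sum (λ x → if P x ∧ (Q y ∧ R x y) then 1 else 0)) ≡⟨ sum-cong-≗ column ⟨
  count Q                                                    ∎
  where
  open ≡-Reasoning
  row : ∀ x → (if P x then 1 else 0) ≡ count (λ y → P x ∧ (Q y ∧ R x y))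
  row x with P x in Px
  ... | true  = sym (P⇒one x (subst T (sym Px) _))
  ... | false = sym (count-none {m} (λ _ → false) λ _ ())
  column : ∀ y → (if Q y then 1 else 0) ≡ count (λ x → P x ∧ (Q y ∧ R x y))
  column y with Q y in Qy
  ... | true  = sym (Q⇒one y (subst T (sym Qy) _))
  ... | false = sym (count-none (λ x → P x ∧ false) λ x h → proj₂ (T-∧-elim {P x} h))

not-⌊<?⌋ : {i j : Fin m} → i ≢ j → not ⌊ i <? j ⌋ ≡ ⌊ j <? i ⌋
not-⌊<?⌋ {i = i} {j} i≢j with i <? j | j <? i
... | yes i<j | yes j<i = ⊥-elim (Finₚ.<-asym i<j j<i)
... | yes _   | no _    = refl
... | no _    | yes _   = refl
... | no i≮j  | no j≮i with Finₚ.<-cmp i j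
...   | tri< i<j _ _ = ⊥-elim (i≮j i<j)
...   | tri≈ _ i≡j _ = ⊥-elim (i≢j i≡j)
...   | tri> _ _ j<i = ⊥-elim (j≮i j<i)

count-involution-even : (τ : Fin m → Fin m) → (∀ x → τ (τ x) ≡ x) → (∀ x → τ x ≢ x) →
  (P : Fin m → Bool) → (∀ x → P (τ x) ≡ P x) → ∃[ c ] count P ≡ c ℕ.+ c
count-involution-even τ τ-invol τ-fpf P P-τ =
  count lowerEnds , trans (count-split P lower) (cong (count lowerEnds ℕ.+_) upper≡lower)
  where
  lower lowerEnds upperEnds : Fin _ → Bool
  lower x = ⌊ x <? τ x ⌋
  lowerEnds x = P x ∧ lower x
  upperEnds x = P x ∧ lower (τ x)
  not-lower : ∀ x → not (lower x) ≡ lower (τ x)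
  not-lower x = trans (not-⌊<?⌋ (τ-fpf x ∘ sym)) (cong (λ y → ⌊ τ x <? y ⌋) (sym (τ-invol x)))
  partner : ∀ x → T (lowerEnds x) → T (upperEnds (τ x))
  partner x ends = subst T (sym (cong₂ _∧_ (P-τ x) (cong lower (τ-invol x)))) ends
  partner⁻ : ∀ y → T (upperEnds y) → T (lowerEnds (τ y))
  partner⁻ y ends = subst T (sym (cong (_∧ lower (τ y)) (P-τ y))) ends
  upper≡lower : count (λ x → P x ∧ not (lower x)) ≡ count lowerEnds
  upper≡lower = trans (count-cong (λ x → cong (P x ∧_) (not-lower x)))
    (sym (count-perfect-matching (λ x y → ⌊ y ≟ τ x ⌋) lowerEnds upperEnds
      (λ x ends → count-unique _ (τ x) (T-∧-intro (partner x ends) (fromWitness refl))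
        (λ z h → toWitness (proj₂ (T-∧-elim {upperEnds z} h))))
      (λ y ends → count-unique _ (τ y) (T-∧-intro (partner⁻ y ends) (fromWitness (sym (τ-invol y))))
        (λ z h → trans (sym (τ-invol z)) (cong τ (sym (toWitness (proj₂ (T-∧-elim {lowerEnds z} h)))))))))

⌊double+n/2⌋ : ∀ c n → ⌊ c ℕ.+ c ℕ.+ n /2⌋ ≡ c ℕ.+ ⌊ n /2⌋
⌊double+n/2⌋ zero    n = refl
⌊double+n/2⌋ (suc c) n =
  trans (cong (λ x → ⌊ suc x ℕ.+ n /2⌋) (ℕₚ.+-suc c c)) (cong suc (⌊double+n/2⌋ c n))

⌊double/2⌋ : ∀ c → ⌊ c ℕ.+ c /2⌋ ≡ c
⌊double/2⌋ c =
  trans (cong ⌊_/2⌋ (sym (ℕₚ.+-identityʳ (c ℕ.+ c)))) (trans (⌊double+n/2⌋ c 0) (ℕₚ.+-identityʳ c))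

-- Orbits of a list of generators

any-allFin⁺ : (p : Fin m → Bool) (x : Fin m) → T (p x) → T (any p (allFin m))
any-allFin⁺ p x px = any⁺ p (lose (∈-allFin x) px)

any-allFin⁻ : (p : Fin m → Bool) → T (any p (allFin m)) → ∃[ x ] T (p x)
any-allFin⁻ {m} p h = let x , _ , px = find (any⁻ p (allFin m) h) in x , px

Gens : ℕ → Set
Gens m = List (Fin m → Fin m)

Involutive : Gens m → Set
Involutive gs = ∀ {g} → g ∈ gs → ∀ x → g (g x) ≡ x

module Orbits (gs : Gens m) where

  Closed : (Fin m → Bool) → Set
  Closed P = ∀ y → T (step gs P y) → T (P y)

  step-extensive : (P : Fin m → Bool) {y : Fin m} → T (P y) → T (step gs P y)
  step-extensive P Py = Equivalence.from T-∨ (inj₁ Py)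

  step-gen : (P : Fin m → Bool) {g : Fin m → Fin m} → g ∈ gs →
    ∀ {z} → T (P z) → T (step gs P (g z))
  step-gen P {g} g∈gs {z} Pz = Equivalence.from T-∨ (inj₂
    (any⁺ (λ h → img h P (g z)) (lose g∈gs (any-allFin⁺ _ z (T-∧-intro Pz (fromWitness refl))))))

  step-elim : (P : Fin m → Bool) {y : Fin m} → T (step gs P y) →
    T (P y) ⊎ ∃[ g ] g ∈ gs × ∃[ z ] T (P z) × g z ≡ y
  step-elim P {y} h with Equivalence.to T-∨ h
  ... | inj₁ Py = inj₁ Py
  ... | inj₂ imgs with find (any⁻ (λ g → img g P y) gs imgs)
  ...   | g , g∈gs , img-y with any-allFin⁻ _ img-y
  ...     | z , Pz∧gz≡y =
    let Pz , gz≡y = T-∧-elim {P z} Pz∧gz≡y in inj₂ (g , g∈gs , z , Pz , toWitness gz≡y)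

  step-closed : (P : Fin m → Bool) → Closed P → Closed (step gs P)
  step-closed P closed y h with step-elim (step gs P) h
  ... | inj₁ stepPy = stepPy
  ... | inj₂ (g , g∈gs , z , stepPz , refl) = step-gen P g∈gs (closed z stepPz)

  closed-or-escapes : (P : Fin m → Bool) → Closed P ⊎ ∃[ y ] T (step gs P y) × ¬ T (P y)
  closed-or-escapes P with Finₚ.any? (λ y → T? (step gs P y ∧ not (P y)))
  ... | yes (y , h) = let s , ¬p = T-∧-elim {step gs P y} h in inj₂ (y , s , T-not⇒¬T ¬p)
  ... | no ¬escape =
    inj₁ λ y s → decidable-stable (T? _) (λ ¬p → ¬escape (y , T-∧-intro s (¬T⇒T-not ¬p)))

  iterStep-extensive : (P : Fin m → Bool) (k : ℕ) {y : Fin m} → T (P y) → T (iterStep k gs P y)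
  iterStep-extensive P zero    Py = Py
  iterStep-extensive P (suc k) Py = step-extensive _ (iterStep-extensive P k Py)

  -- each step either closes the set or adds an element, so after m steps it is closed
  iterStep-closed-or-grows : (P : Fin m → Bool) {x : Fin m} → T (P x) →
    ∀ k → Closed (iterStep k gs P) ⊎ k ℕ.< count (iterStep k gs P)
  iterStep-closed-or-grows P Px zero = inj₂ (count-pos P _ Px)
  iterStep-closed-or-grows P Px (suc k) with iterStep-closed-or-grows P Px k
  ... | inj₁ closed = inj₁ (step-closed _ closed)
  ... | inj₂ k<count with closed-or-escapes (iterStep k gs P)
  ...   | inj₁ closed = inj₁ (step-closed _ closed)
  ...   | inj₂ (y , s , ¬p) =
    inj₂ (ℕₚ.≤-trans (s≤s k<count) (count-mono-< _ _ (λ _ → step-extensive _) y s ¬p))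

  Orbit : Fin m → Fin m → Set
  Orbit x y = T (orbit gs x y)

  orbit-closed : (x : Fin m) → Closed (orbit gs x)
  orbit-closed x with iterStep-closed-or-grows (λ y → ⌊ y ≟ x ⌋) {x} (fromWitness refl) m
  ... | inj₁ closed = closed
  ... | inj₂ m<count = ⊥-elim (ℕₚ.<⇒≱ m<count (count-≤ _))

  orbit-refl : (x : Fin m) → Orbit x x
  orbit-refl x = iterStep-extensive _ m (fromWitness refl)

  orbit-gen : {g : Fin m → Fin m} → g ∈ gs → {x y : Fin m} → Orbit x y → Orbit x (g y)
  orbit-gen g∈gs {x} xy = orbit-closed x _ (step-gen _ g∈gs xy)

  orbit-ind : (S : Fin m → Set) {x : Fin m} → S x →
    (∀ {g} → g ∈ gs → ∀ {y} → S y → S (g y)) → ∀ {y} → Orbit x y → S y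
  orbit-ind S {x} Sx S-closed = go m
    where
    go : ∀ k {y} → T (iterStep k gs (λ y → ⌊ y ≟ x ⌋) y) → S y
    go zero    y≡x = subst S (sym (toWitness y≡x)) Sx
    go (suc k) h with step-elim _ h
    ... | inj₁ h′ = go k h′
    ... | inj₂ (g , g∈gs , z , h′ , refl) = S-closed g∈gs (go k h′)

  orbit-trans : {x y z : Fin m} → Orbit x y → Orbit y z → Orbit x z
  orbit-trans {x} xy = orbit-ind (Orbit x) xy (λ g∈gs → orbit-gen g∈gs)

  orbit-sym : Involutive gs → {x y : Fin m} → Orbit x y → Orbit y x
  orbit-sym invol {x} = orbit-ind (λ y → Orbit y x) (orbit-refl x) back
    where
    back : ∀ {g} → g ∈ gs → ∀ {y} → Orbit y x → Orbit (g y) x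
    back {g} g∈gs {y} =
      orbit-trans (subst (Orbit (g y)) (invol g∈gs y) (orbit-gen g∈gs (orbit-refl (g y))))

open Orbits using (Orbit; orbit-refl; orbit-gen; orbit-ind; orbit-trans; orbit-sym)

orbit-isEquivalence : (gs : Gens m) → Involutive gs → IsEquivalence (Orbit gs)
orbit-isEquivalence gs invol = record
  { refl = orbit-refl gs _ ; sym = orbit-sym gs invol ; trans = orbit-trans gs }

AgreesWithSome : Gens m → (Fin m → Fin m) → Set
AgreesWithSome hs g = ∀ z → ∃[ h ] h ∈ hs × g z ≡ h z

_⊑_ : Gens m → Gens m → Set
gs ⊑ hs = All (AgreesWithSome hs) gs

orbit-mono : {gs hs : Gens m} → gs ⊑ hs → {x y : Fin m} → Orbit gs x y → Orbit hs x y
orbit-mono {gs = gs} {hs} gs⊑hs {x} = orbit-ind gs (Orbit hs x) (orbit-refl hs x) closed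
  where
  closed : ∀ {g} → g ∈ gs → ∀ {y} → Orbit hs x y → Orbit hs x (g y)
  closed g∈gs {y} xy with All.lookup gs⊑hs g∈gs y
  ... | h , h∈hs , gy≡hy = subst (Orbit hs x) (sym gy≡hy) (orbit-gen hs h∈hs xy)

orbit-cong : {gs hs : Gens m} → gs ⊑ hs → hs ⊑ gs → ∀ x y → orbit gs x y ≡ orbit hs x y
orbit-cong gs⊑hs hs⊑gs x y = T-ext (orbit-mono gs⊑hs) (orbit-mono hs⊑gs)

agreesWith-∈ : {hs : Gens m} {h : Fin m → Fin m} → h ∈ hs → AgreesWithSome hs h
agreesWith-∈ h∈hs z = _ , h∈hs , refl

agreesWith-if : {hs : Gens m} (b : Fin m → Bool) {g h₁ h₂ : Fin m → Fin m} →
  h₁ ∈ hs → h₂ ∈ hs →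
  (∀ z → g z ≡ (if b z then h₁ z else h₂ z)) → AgreesWithSome hs g
agreesWith-if b h₁∈hs h₂∈hs g≡ z with b z | g≡ z
... | true  | gz≡h₁z = _ , h₁∈hs , gz≡h₁z
... | false | gz≡h₂z = _ , h₂∈hs , gz≡h₂z

-- Counting orbits by their least elements

isLeast : (Fin m → Fin m → Bool) → Fin m → Bool
isLeast {m} R x = not (any (λ y → ⌊ y <? x ⌋ ∧ R x y) (allFin m))

countOrbits≡count : (S : Fin m → Bool) (gs : Gens m) →
  countOrbits S gs ≡ count (λ x → S x ∧ isLeast (orbit gs) x)
countOrbits≡count S gs = countTrue≡count (λ x → S x ∧ isLeast (orbit gs) x)

meets : (Fin m → Fin m → Bool) → (Fin m → Bool) → Fin m → Bool
meets {m} R S x = any (λ y → R x y ∧ S y) (allFin m)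

isLeast-intro : (R : Fin m → Fin m → Bool) {x : Fin m} →
  (∀ y → y Fin.< x → ¬ T (R x y)) → T (isLeast R x)
isLeast-intro R {x} below = ¬T⇒T-not λ h →
  let y , y<x∧xy = any-allFin⁻ _ h
      y<x , xy = T-∧-elim {⌊ y <? x ⌋} y<x∧xy
  in below y (toWitness y<x) xy

isLeast-elim : (R : Fin m → Fin m → Bool) {x y : Fin m} → T (isLeast R x) → y Fin.< x → ¬ T (R x y)
isLeast-elim R {x} {y} least y<x xy =
  T-not⇒¬T least (any-allFin⁺ _ y (T-∧-intro (fromWitness y<x) xy))

isLeast-cong : {R R′ : Fin m → Fin m → Bool} {x : Fin m} →
  R x ≗ R′ x → isLeast R x ≡ isLeast R′ x
isLeast-cong {m} {x = x} Rx≗R′x =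
  cong (not ∘ or) (map-cong (λ y → cong (⌊ y <? x ⌋ ∧_) (Rx≗R′x y)) (allFin m))

least-element : (Q : Fin m → Bool) {y : Fin m} → T (Q y) →
  ∃[ z ] T (Q z) × (∀ w → w Fin.< z → ¬ T (Q w))
least-element {suc m} Q {y} Qy with Q zero in Q₀
... | true  = zero , subst T (sym Q₀) _ , λ _ ()
least-element {suc m} Q {zero}  Qy | false = ⊥-elim (subst T Q₀ Qy)
least-element {suc m} Q {suc y} Qy | false with least-element (Q ∘ suc) Qy
... | z , Qz , below = suc z , Qz , below′
  where
  below′ : ∀ w → w Fin.< suc z → ¬ T (Q w)
  below′ zero    _         = subst T Q₀
  below′ (suc w) (s≤s w<z) = below w w<z

-- an R-class meeting S is matched with the least element of its trace on S
module _ (R : Fin m → Fin m → Bool) (R-equiv : IsEquivalence (λ x y → T (R x y))) where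
  open IsEquivalence R-equiv renaming (refl to R-refl; sym to R-sym; trans to R-trans)

  count-least-meeting : (R′ : Fin m → Fin m → Bool) (S : Fin m → Bool) →
    (∀ {x y} → T (S x) → T (R′ x y) → T (R x y) × T (S y)) →
    (∀ {x y} → T (S x) → T (R x y) → T (S y) → T (R′ x y)) →
    count (λ x → isLeast R x ∧ meets R S x) ≡ count (λ x → S x ∧ isLeast R′ x)
  count-least-meeting R′ S R′⇒R ⇒R′ = count-perfect-matching R _ _ one-rep-per-class one-class-per-rep
    where
    one-rep-per-class : ∀ x → T (isLeast R x ∧ meets R S x) →
      count (λ y → (S y ∧ isLeast R′ y) ∧ R x y) ≡ 1
    one-rep-per-class x h with any-allFin⁻ (λ y → R x y ∧ S y) (proj₂ (T-∧-elim {isLeast R x} h))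
    ... | a , xa∧Sa with least-element (λ w → R x w ∧ S w) {a} xa∧Sa
    ... | b , xb∧Sb , below =
      count-unique _ b (T-∧-intro (T-∧-intro Sb (isLeast-intro R′ b-least)) xb) unique
      where
      xb : T (R x b)
      xb = proj₁ (T-∧-elim {R x b} xb∧Sb)
      Sb : T (S b)
      Sb = proj₂ (T-∧-elim {R x b} xb∧Sb)
      b-least : ∀ w → w Fin.< b → ¬ T (R′ b w)
      b-least w w<b b′w = let bw , Sw = R′⇒R Sb b′w in below w w<b (T-∧-intro (R-trans xb bw) Sw)
      unique : ∀ z → T ((S z ∧ isLeast R′ z) ∧ R x z) → z ≡ b
      unique z h with T-∧-elim {S z ∧ isLeast R′ z} h
      ... | Sz∧least , xz with T-∧-elim {S z} Sz∧least | Finₚ.<-cmp z b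
      ...   | Sz , _     | tri< z<b _ _ = ⊥-elim (below z z<b (T-∧-intro xz Sz))
      ...   | _  , _     | tri≈ _ z≡b _ = z≡b
      ...   | Sz , least | tri> _ _ b<z =
        ⊥-elim (isLeast-elim R′ least b<z (⇒R′ Sz (R-trans (R-sym xz) xb) Sb))
    one-class-per-rep : ∀ y → T (S y ∧ isLeast R′ y) →
      count (λ x → (isLeast R x ∧ meets R S x) ∧ R x y) ≡ 1
    one-class-per-rep y h with least-element (R y) (R-refl {y})
    ... | b , yb , below =
      count-unique _ b (T-∧-intro (T-∧-intro (isLeast-intro R b-least) b-meets) (R-sym yb)) unique
      where
      b-least : ∀ w → w Fin.< b → ¬ T (R b w)
      b-least w w<b bw = below w w<b (R-trans yb bw)
      b-meets : T (meets R S b)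
      b-meets = any-allFin⁺ _ y (T-∧-intro (R-sym yb) (proj₁ (T-∧-elim {S y} h)))
      unique : ∀ z → T ((isLeast R z ∧ meets R S z) ∧ R z y) → z ≡ b
      unique z h with T-∧-elim {isLeast R z ∧ meets R S z} h
      ... | least∧meets , zy with Finₚ.<-cmp z b
      ...   | tri< z<b _ _ = ⊥-elim (below z z<b (R-sym zy))
      ...   | tri≈ _ z≡b _ = z≡b
      ...   | tri> _ _ b<z =
        ⊥-elim (isLeast-elim R (proj₁ (T-∧-elim {isLeast R z} least∧meets)) b<z (R-trans zy yb))

countOrbits-cong : (S : Fin m → Bool) {gs hs : Gens m} → gs ⊑ hs → hs ⊑ gs →
  countOrbits S gs ≡ countOrbits S hs
countOrbits-cong S {gs} {hs} gs⊑hs hs⊑gs = begin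
  countOrbits S gs
    ≡⟨ countOrbits≡count S gs ⟩
  count (λ x → S x ∧ isLeast (orbit gs) x)
    ≡⟨ count-cong (λ x → cong (S x ∧_) (isLeast-cong {R = orbit gs} {orbit hs} (orbit-cong gs⊑hs hs⊑gs x))) ⟩
  count (λ x → S x ∧ isLeast (orbit hs) x)
    ≡⟨ countOrbits≡count S hs ⟨
  countOrbits S hs
    ∎
  where open ≡-Reasoning

countOrbits-split : (S : Fin m → Bool) (gs : Gens m) →
  countOrbits (λ _ → true) gs ≡ countOrbits S gs ℕ.+ countOrbits (not ∘ S) gs
countOrbits-split S gs = begin
  countOrbits (λ _ → true) gs
    ≡⟨ countOrbits≡count (λ _ → true) gs ⟩
  count (isLeast (orbit gs))
    ≡⟨ count-split _ S ⟩
  count (λ x → isLeast (orbit gs) x ∧ S x) ℕ.+ count (λ x → isLeast (orbit gs) x ∧ not (S x))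
    ≡⟨ cong₂ ℕ._+_ (count-cong λ x → ∧-comm _ (S x)) (count-cong λ x → ∧-comm _ (not (S x))) ⟩
  count (λ x → S x ∧ isLeast (orbit gs) x) ℕ.+ count (λ x → not (S x) ∧ isLeast (orbit gs) x)
    ≡⟨ cong₂ ℕ._+_ (countOrbits≡count S gs) (countOrbits≡count (not ∘ S) gs) ⟨
  countOrbits S gs ℕ.+ countOrbits (not ∘ S) gs
    ∎
  where open ≡-Reasoning

AgreeOff : (Fin m → Bool) → Gens m → Gens m → Set
AgreeOff S gs hs = ∀ {g} → g ∈ gs → ∀ z → ¬ T (S z) → ∃[ h ] h ∈ hs × g z ≡ h z

orbit-until : (S : Fin m → Bool) {gs hs : Gens m} → AgreeOff S gs hs → {x y : Fin m} →
  Orbit gs x y → (∃[ z ] T (S z) × Orbit hs x z) ⊎ Orbit hs x y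
orbit-until S {gs} {hs} agree {x} = orbit-ind gs Reached (inj₂ (orbit-refl hs x)) closed
  where
  Reached : Fin _ → Set
  Reached y = (∃[ z ] T (S z) × Orbit hs x z) ⊎ Orbit hs x y
  closed : ∀ {g} → g ∈ gs → ∀ {y} → Reached y → Reached (g y)
  closed g∈gs (inj₁ hitS) = inj₁ hitS
  closed g∈gs {y} (inj₂ xy) with T? (S y)
  ... | yes Sy = inj₁ (y , Sy , xy)
  ... | no ¬Sy with agree g∈gs y ¬Sy
  ...   | h , h∈hs , gy≡hy = inj₂ (subst (Orbit hs x) (sym gy≡hy) (orbit-gen hs h∈hs xy))

meets-transfer : (S : Fin m → Bool) {gs hs : Gens m} → AgreeOff S gs hs → {x : Fin m} →
  T (meets (orbit gs) S x) → T (meets (orbit hs) S x)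
meets-transfer S {gs} {hs} agree {x} h with any-allFin⁻ (λ y → orbit gs x y ∧ S y) h
... | y , xy∧Sy with T-∧-elim {orbit gs x y} xy∧Sy
...   | xy , Sy with orbit-until S agree xy
...     | inj₁ (z , Sz , xz) = any-allFin⁺ _ z (T-∧-intro xz Sz)
...     | inj₂ xy′           = any-allFin⁺ _ y (T-∧-intro xy′ Sy)

orbit-transfer-avoiding : (S : Fin m → Bool) {gs hs : Gens m} → AgreeOff S gs hs → {x y : Fin m} →
  ¬ T (meets (orbit hs) S x) → Orbit gs x y → Orbit hs x y
orbit-transfer-avoiding S agree ¬meets xy with orbit-until S agree xy
... | inj₁ (z , Sz , xz) = ⊥-elim (¬meets (any-allFin⁺ _ z (T-∧-intro xz Sz)))
... | inj₂ xy′           = xy′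

count-least-avoiding : (S : Fin m → Bool) {gs hs : Gens m} → AgreeOff S gs hs → AgreeOff S hs gs →
  count (λ x → isLeast (orbit gs) x ∧ not (meets (orbit gs) S x))
    ≡ count (λ x → not (meets (orbit hs) S x) ∧ isLeast (orbit hs) x)
count-least-avoiding S {gs} {hs} gs~hs hs~gs = count-cong same
  where
  meets-eq : ∀ x → meets (orbit gs) S x ≡ meets (orbit hs) S x
  meets-eq x = T-ext (meets-transfer S gs~hs) (meets-transfer S hs~gs)
  same : ∀ x → isLeast (orbit gs) x ∧ not (meets (orbit gs) S x)
             ≡ not (meets (orbit hs) S x) ∧ isLeast (orbit hs) x
  same x rewrite meets-eq x with meets (orbit hs) S x in meets-hs
  ... | true  = ∧-zeroʳ _
  ... | false = trans (∧-identityʳ _) (isLeast-cong {R = orbit gs} {orbit hs} λ y →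
    T-ext (orbit-transfer-avoiding S gs~hs (subst T meets-hs))
          (orbit-transfer-avoiding S hs~gs (subst T (trans (meets-eq x) meets-hs))))

module _ {A : Set} (f : A → A) where

  iterate-+ : ∀ w i j → iterate f w (i ℕ.+ j) ≡ iterate f (iterate f w i) j
  iterate-+ w zero    j = refl
  iterate-+ w (suc i) j = iterate-+ (f w) i j

  iterate-injective : (∀ {x y} → f x ≡ f y → x ≡ y) →
    ∀ i {x y} → iterate f x i ≡ iterate f y i → x ≡ y
  iterate-injective f-inj zero    eq = eq
  iterate-injective f-inj (suc i) eq = f-inj (iterate-injective f-inj i eq)

-- an injection of a finite set is a permutation, so every point recurs
iterate-recurs : (f : Fin m → Fin m) → (∀ {x y} → f x ≡ f y → x ≡ y) →
  ∀ w → ∃[ k ] k ℕ.< m × iterate f (f w) k ≡ w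
iterate-recurs {m} f f-inj w with Finₚ.pigeonhole (ℕₚ.n<1+n m) (iterate f w ∘ Fin.toℕ)
... | i , j , i<j , same with ℕₚ.m≤n⇒∃[o]m+o≡n i<j
...   | k , i+1+k≡j = k , k<m , sym (iterate-injective f f-inj (Fin.toℕ i) recur)
  where
  j≡1+k+i : Fin.toℕ j ≡ suc k ℕ.+ Fin.toℕ i
  j≡1+k+i = trans (sym i+1+k≡j) (cong suc (ℕₚ.+-comm (Fin.toℕ i) k))
  recur : iterate f w (Fin.toℕ i) ≡ iterate f (iterate f (f w) k) (Fin.toℕ i)
  recur = trans same (trans (cong (iterate f w) j≡1+k+i) (iterate-+ f w (suc k) (Fin.toℕ i)))
  k<m : k ℕ.< m
  k<m = ℕₚ.≤-trans (ℕₚ.m≤m+n (suc k) (Fin.toℕ i))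
                   (subst (ℕ._≤ m) j≡1+k+i (ℕₚ.≤-pred (Finₚ.toℕ<n j)))

-- g steps along a hypervertex boundary, so ρ x, the next flag of A after x on it, walks the
-- boundaries of the sub-hypermap A.
module InducedOrbits {m : ℕ} (A : Fin m → Bool) (t aV X Y : Fin m → Fin m)
  (t-invol : ∀ x → t (t x) ≡ x) (aV-invol : ∀ x → aV (aV x) ≡ x) (A-t : ∀ x → A (t x) ≡ A x)
  (X-invol : ∀ x → X (X x) ≡ x) (X-off : ∀ x → ¬ T (A x) → X x ≡ t x)
  (Y-on : ∀ x → T (A x) → Y x ≡ X x) (A-Y : ∀ x → A (Y x) ≡ A x) where

  g : Fin m → Fin m
  g y = aV (t y)

  ρ : Fin m → Fin m
  ρ x = skipTo A g m (aV x)

  data FirstHit : Fin m → Fin m → Set where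
    hit  : ∀ {w} → T (A w) → FirstHit w w
    pass : ∀ {w b} → ¬ T (A w) → FirstHit (g w) b → FirstHit w b

  firstHit-A : ∀ {w b} → FirstHit w b → T (A b)
  firstHit-A (hit Aw)    = Aw
  firstHit-A (pass _ fh) = firstHit-A fh

  firstHit-hit : ∀ {w b} → T (A w) → FirstHit w b → b ≡ w
  firstHit-hit _  (hit _)      = refl
  firstHit-hit Aw (pass ¬Aw _) = ⊥-elim (¬Aw Aw)

  firstHit-pass⁻ : ∀ {w b} → ¬ T (A w) → FirstHit w b → FirstHit (g w) b
  firstHit-pass⁻ ¬Aw (hit Aw)    = ⊥-elim (¬Aw Aw)
  firstHit-pass⁻ _   (pass _ fh) = fh

  skipTo-firstHit : ∀ k w q → q ℕ.< k → T (A (iterate g w q)) → FirstHit w (skipTo A g k w)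
  skipTo-firstHit (suc k) w q q<k Aq with A w in Aw
  ... | true = hit (subst T (sym Aw) _)
  skipTo-firstHit (suc k) w zero    q<k       Aq | false = ⊥-elim (subst T Aw Aq)
  skipTo-firstHit (suc k) w (suc q) (s≤s q<k) Aq | false =
    pass (subst T Aw) (skipTo-firstHit k (g w) q q<k Aq)

  A-X : ∀ {y} → T (A y) → T (A (X y))
  A-X {y} Ay = subst T (sym (trans (cong A (sym (Y-on y Ay))) (A-Y y))) Ay

  ¬A-t : ∀ {w} → ¬ T (A w) → ¬ T (A (t w))
  ¬A-t {w} ¬Aw = ¬Aw ∘ subst T (A-t w)

  g-t : ∀ y → g (t y) ≡ aV y
  g-t y = cong aV (t-invol y)

  g-t-aV : ∀ y → g (t (aV y)) ≡ y
  g-t-aV y = trans (g-t (aV y)) (aV-invol y)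

  g-injective : ∀ {x y} → g x ≡ g y → x ≡ y
  g-injective {x} {y} eq = trans (sym (t-invol x)) (trans (cong t aVt≡aVt) (t-invol y))
    where
    aVt≡aVt : t x ≡ t y
    aVt≡aVt = trans (sym (aV-invol (t x))) (trans (cong aV eq) (aV-invol (t y)))

  -- walking from aV z along the boundary returns to the A-flag t z
  ρ-firstHit : ∀ {z} → T (A z) → FirstHit (aV z) (ρ z)
  ρ-firstHit {z} Az with iterate-recurs g g-injective (t z)
  ... | k , k<m , returns =
    skipTo-firstHit m (aV z) k k<m (subst (T ∘ A) (sym lands) (subst T (sym (A-t z)) Az))
    where
    lands : iterate g (aV z) k ≡ t z
    lands = trans (cong (λ w → iterate g w k) (sym (g-t z))) returns

  XaV ρY taV : Gens m
  XaV = X ∷ aV ∷ []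
  ρY  = ρ ∷ Y ∷ []
  taV = t ∷ aV ∷ []

  XaV-involutive : ∀ {h} → h ∈ XaV → ∀ x → h (h x) ≡ x
  XaV-involutive (here refl)         = X-invol
  XaV-involutive (there (here refl)) = aV-invol

  firstHit-XaV : ∀ {x w b} → FirstHit w b → Orbit XaV x w → Orbit XaV x b
  firstHit-XaV (hit _) xw = xw
  firstHit-XaV {x} {w} (pass ¬Aw fh) xw =
    firstHit-XaV fh (orbit-gen XaV (there (here refl))
      (subst (Orbit XaV x) (X-off w ¬Aw) (orbit-gen XaV (here refl) xw)))

  ρY⇒XaV : ∀ {x y} → T (A x) → Orbit ρY x y → Orbit XaV x y × T (A y)
  ρY⇒XaV {x} Ax = orbit-ind ρY (λ y → Orbit XaV x y × T (A y)) (orbit-refl XaV x , Ax) closed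
    where
    closed : ∀ {h} → h ∈ ρY → ∀ {y} →
      Orbit XaV x y × T (A y) → Orbit XaV x (h y) × T (A (h y))
    closed (here refl) (xy , Ay) =
      firstHit-XaV (ρ-firstHit Ay) (orbit-gen XaV (there (here refl)) xy) , firstHit-A (ρ-firstHit Ay)
    closed (there (here refl)) {y} (xy , Ay) =
      subst (Orbit XaV x) (sym (Y-on y Ay)) (orbit-gen XaV (here refl) xy) , subst T (sym (A-Y y)) Ay

  module _ {x : Fin m} (Ax : T (A x)) where

    Reach : Fin m → Set
    Reach w = ∃[ b ] FirstHit w b × Orbit ρY x b

    -- Reach (t y) looks the other way along the boundary; closure under X = t off A needs both.
    Reachable : Fin m → Set
    Reachable y = Reach y × (¬ T (A y) → Reach (t y))

    reach-A : ∀ {y} → T (A y) → Reach y → Orbit ρY x y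
    reach-A Ay (b , fh , xb) = subst (Orbit ρY x) (firstHit-hit Ay fh) xb

    reachable-A : ∀ {y} → T (A y) → Orbit ρY x y → Reachable y
    reachable-A Ay xy = (_ , hit Ay , xy) , λ ¬Ay → ⊥-elim (¬Ay Ay)

    reachable-X : ∀ {y} → Reachable y → Reachable (X y)
    reachable-X {y} (reach-y , reach-ty) with T? (A y)
    ... | yes Ay = reachable-A (A-X Ay)
                     (subst (Orbit ρY x) (Y-on y Ay) (orbit-gen ρY (there (here refl)) (reach-A Ay reach-y)))
    ... | no ¬Ay rewrite X-off y ¬Ay = reach-ty ¬Ay , λ _ → subst Reach (sym (t-invol y)) reach-y

    reach-forward : ∀ {y} → ¬ T (A y) → Reach (t y) → Reach (aV y)
    reach-forward {y} ¬Ay (b , fh , xb) =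
      b , subst (λ w → FirstHit w b) (g-t y) (firstHit-pass⁻ (¬A-t ¬Ay) fh) , xb

    reach-backward : ∀ {y} → ¬ T (A (aV y)) → Reach y → Reach (t (aV y))
    reach-backward {y} ¬AaVy (b , fh , xb) =
      b , pass (¬A-t ¬AaVy) (subst (λ w → FirstHit w b) (sym (g-t-aV y)) fh) , xb

    reachable-aV : ∀ {y} → Reachable y → Reachable (aV y)
    reachable-aV {y} (reach-y , reach-ty) with T? (A y) | T? (A (aV y))
    ... | yes Ay | yes AaVy =
      reachable-A AaVy (reach-A AaVy (ρ y , ρ-firstHit Ay , orbit-gen ρY (here refl) (reach-A Ay reach-y)))
    ... | yes Ay | no ¬AaVy =
      (ρ y , ρ-firstHit Ay , orbit-gen ρY (here refl) (reach-A Ay reach-y)) ,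
      λ _ → reach-backward ¬AaVy (y , hit Ay , reach-A Ay reach-y)
    ... | no ¬Ay | yes AaVy = reachable-A AaVy (reach-A AaVy (reach-forward ¬Ay (reach-ty ¬Ay)))
    ... | no ¬Ay | no ¬AaVy = reach-forward ¬Ay (reach-ty ¬Ay) , λ _ → reach-backward ¬AaVy reach-y

    XaV⇒ρY : ∀ {y} → Orbit XaV x y → T (A y) → Orbit ρY x y
    XaV⇒ρY xy Ay =
      reach-A Ay (proj₁ (orbit-ind XaV Reachable (reachable-A Ax (orbit-refl ρY x)) closed xy))
      where
      closed : ∀ {h} → h ∈ XaV → ∀ {y} → Reachable y → Reachable (h y)
      closed (here refl)         = reachable-X
      closed (there (here refl)) = reachable-aV

  XaV~taV : AgreeOff A XaV taV
  XaV~taV (here refl)         z ¬Az = t , here refl , X-off z ¬Az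
  XaV~taV (there (here refl)) z _   = aV , there (here refl) , refl

  taV~XaV : AgreeOff A taV XaV
  taV~XaV (here refl)         z ¬Az = X , here refl , sym (X-off z ¬Az)
  taV~XaV (there (here refl)) z _   = aV , there (here refl) , refl

  countOrbits-XaV : countOrbits (λ _ → true) XaV
    ≡ countOrbits A ρY ℕ.+ countOrbits (λ x → not (meets (orbit taV) A x)) taV
  countOrbits-XaV = begin
    countOrbits (λ _ → true) XaV
      ≡⟨ countOrbits≡count (λ _ → true) XaV ⟩
    count (isLeast (orbit XaV))
      ≡⟨ count-split _ (meets (orbit XaV) A) ⟩
    count (λ x → isLeast (orbit XaV) x ∧ meets (orbit XaV) A x)
      ℕ.+ count (λ x → isLeast (orbit XaV) x ∧ not (meets (orbit XaV) A x))
      ≡⟨ cong₂ ℕ._+_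
           (count-least-meeting (orbit XaV) (orbit-isEquivalence XaV XaV-involutive) (orbit ρY) A
             ρY⇒XaV (λ Ax xy Ay → XaV⇒ρY Ax xy Ay))
           (count-least-avoiding A XaV~taV taV~XaV) ⟩
    count (λ x → A x ∧ isLeast (orbit ρY) x)
      ℕ.+ count (λ x → not (meets (orbit taV) A x) ∧ isLeast (orbit taV) x)
      ≡⟨ cong₂ ℕ._+_ (countOrbits≡count A ρY) (countOrbits≡count _ taV) ⟨
    countOrbits A ρY ℕ.+ countOrbits (λ x → not (meets (orbit taV) A x)) taV
      ∎
    where open ≡-Reasoning

-- Parameters of a partial dual

-- dualising twice restores the generators of H
if-diag : ∀ {A : Set} b {x y : A} → x ≡ (if b then (if b then x else y) else (if b then y else x))
if-diag false = refl
if-diag true  = refl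

swap⊑ : {f g : Fin m → Fin m} → (f ∷ g ∷ []) ⊑ (g ∷ f ∷ [])
swap⊑ = agreesWith-∈ (there (here refl)) ∷ agreesWith-∈ (here refl) ∷ []

module _ (H : RibbonHypermap) (A : EdgeSubset H) where
  private
    Hᴬ : RibbonHypermap
    Hᴬ = partialDual H A

    module DualVertices = InducedOrbits (inA A) (t H) (aV H) (t Hᴬ) (aE H)
      (t-invol H) (aV-invol H) (inA-t A) (t-invol Hᴬ)
      (λ _ → if-¬T) (λ _ Ax → sym (if-T Ax)) (inA-aE A)

    module SubVertices = InducedOrbits (inA A) (t H) (aV H) (t H) (t H)
      (t-invol H) (aV-invol H) (inA-t A) (t-invol H)
      (λ _ _ → refl) (λ _ _ → refl) (inA-t A)

    cᴬ isolatedᴬ : ℕ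
    cᴬ = HData.nIsoE (subData H A)
    isolatedᴬ = countOrbits (λ x → not (meets (orbit (t H ∷ aV H ∷ [])) (inA A) x)) (t H ∷ aV H ∷ [])

  v-partialDual : v Hᴬ ℕ.+ cᴬ ≡ fD (subData H A)
  v-partialDual = begin
    v Hᴬ ℕ.+ cᴬ
      ≡⟨ cong (λ c → c ℕ.+ isoV H ℕ.+ cᴬ) DualVertices.countOrbits-XaV ⟩
    boundaries ℕ.+ isolatedᴬ ℕ.+ isoV H ℕ.+ cᴬ
      ≡⟨ rearrange boundaries isolatedᴬ (isoV H) cᴬ ⟩
    fD (subData H A)
      ∎
    where
    open ≡-Reasoning
    boundaries : ℕ
    boundaries = countOrbits (inA A) DualVertices.ρY
    rearrange : ∀ a b c d → a ℕ.+ b ℕ.+ c ℕ.+ d ≡ a ℕ.+ (c ℕ.+ b) ℕ.+ d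
    rearrange = ℕ-Solver.solve-∀

  v-subData : vD (subData H A) ≡ v H
  v-subData = begin
    vD (subData H A)
      ≡⟨ rearrange vertices isolatedᴬ (isoV H) ⟩
    vertices ℕ.+ isolatedᴬ ℕ.+ isoV H
      ≡⟨ cong (λ c → c ℕ.+ isolatedᴬ ℕ.+ isoV H) (countOrbits-cong (inA A) swap⊑ swap⊑) ⟩
    countOrbits (inA A) SubVertices.ρY ℕ.+ isolatedᴬ ℕ.+ isoV H
      ≡⟨ cong (ℕ._+ isoV H) SubVertices.countOrbits-XaV ⟨
    v H
      ∎
    where
    open ≡-Reasoning
    vertices : ℕ
    vertices = countOrbits (inA A) (t H ∷ SubVertices.ρ ∷ [])
    rearrange : ∀ a b c → a ℕ.+ (c ℕ.+ b) ≡ a ℕ.+ b ℕ.+ c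
    rearrange = ℕ-Solver.solve-∀

isoE-split : (H : RibbonHypermap) (A : EdgeSubset H) →
  isoE H ≡ HData.nIsoE (subData H A) ℕ.+ HData.nIsoE (subData H (complement A))
isoE-split H A = begin
  isoE H
    ≡⟨ count-all (isoE H) ⟨
  count {isoE H} (λ _ → true)
    ≡⟨ count-split _ (isoA A) ⟩
  count (isoA A) ℕ.+ count (not ∘ isoA A)
    ≡⟨ cong₂ ℕ._+_ (countTrue≡count (isoA A)) (countTrue≡count (not ∘ isoA A)) ⟨
  countTrue (isoA A) ℕ.+ countTrue (not ∘ isoA A)
    ∎
  where open ≡-Reasoning

module _ (H : RibbonHypermap) (A : EdgeSubset H) where
  private
    Hᴬ Hᴬᶜ : RibbonHypermap
    Hᴬ  = partialDual H A
    Hᴬᶜ = partialDual H (complement A)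
    cᴬ cᴬᶜ : ℕ
    cᴬ  = HData.nIsoE (subData H A)
    cᴬᶜ = HData.nIsoE (subData H (complement A))

  f-partialDual : f Hᴬ ≡ fD (subData H (complement A)) ℕ.+ cᴬ
  f-partialDual = begin
    f Hᴬ
      ≡⟨ cong (λ c → c ℕ.+ isoV H ℕ.+ isoE H) (countOrbits-cong _ faces⊑ ⊑faces) ⟩
    v Hᴬᶜ ℕ.+ isoE H
      ≡⟨ cong (v Hᴬᶜ ℕ.+_) (isoE-split H A) ⟩
    v Hᴬᶜ ℕ.+ (cᴬ ℕ.+ cᴬᶜ)
      ≡⟨ rearrange (v Hᴬᶜ) cᴬ cᴬᶜ ⟩
    v Hᴬᶜ ℕ.+ cᴬᶜ ℕ.+ cᴬ
      ≡⟨ cong (ℕ._+ cᴬ) (v-partialDual H (complement A)) ⟩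
    fD (subData H (complement A)) ℕ.+ cᴬ
      ∎
    where
    open ≡-Reasoning
    -- both are t on the flags of A and aE elsewhere
    aEᴬ≗tᴬᶜ : ∀ z → aE Hᴬ z ≡ t Hᴬᶜ z
    aEᴬ≗tᴬᶜ z = sym (if-not (inA A z))
    faces⊑ : (aV H ∷ aE Hᴬ ∷ []) ⊑ (t Hᴬᶜ ∷ aV H ∷ [])
    faces⊑ = agreesWith-∈ (there (here refl)) ∷ (λ z → _ , here refl , aEᴬ≗tᴬᶜ z) ∷ []
    ⊑faces : (t Hᴬᶜ ∷ aV H ∷ []) ⊑ (aV H ∷ aE Hᴬ ∷ [])
    ⊑faces = (λ z → _ , there (here refl) , sym (aEᴬ≗tᴬᶜ z)) ∷ agreesWith-∈ (here refl) ∷ []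
    rearrange : ∀ a b c → a ℕ.+ (b ℕ.+ c) ≡ a ℕ.+ c ℕ.+ b
    rearrange = ℕ-Solver.solve-∀

  k-partialDual : k Hᴬ ≡ k H
  k-partialDual = cong (λ c → c ℕ.+ isoV H ℕ.+ isoE H) (countOrbits-cong _ dual⊑ ⊑dual)
    where
    t∈ : t H ∈ (t H ∷ aV H ∷ aE H ∷ [])
    t∈ = here refl
    aE∈ : aE H ∈ (t H ∷ aV H ∷ aE H ∷ [])
    aE∈ = there (there (here refl))
    t′∈ : t Hᴬ ∈ (t Hᴬ ∷ aV H ∷ aE Hᴬ ∷ [])
    t′∈ = here refl
    aE′∈ : aE Hᴬ ∈ (t Hᴬ ∷ aV H ∷ aE Hᴬ ∷ [])
    aE′∈ = there (there (here refl))
    dual⊑ : (t Hᴬ ∷ aV H ∷ aE Hᴬ ∷ []) ⊑ (t H ∷ aV H ∷ aE H ∷ [])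
    dual⊑ = agreesWith-if (inA A) aE∈ t∈ (λ _ → refl)
          ∷ agreesWith-∈ (there (here refl))
          ∷ agreesWith-if (inA A) t∈ aE∈ (λ _ → refl) ∷ []
    ⊑dual : (t H ∷ aV H ∷ aE H ∷ []) ⊑ (t Hᴬ ∷ aV H ∷ aE Hᴬ ∷ [])
    ⊑dual = agreesWith-if (inA A) aE′∈ t′∈ (λ z → if-diag (inA A z))
          ∷ agreesWith-∈ (there (here refl))
          ∷ agreesWith-if (inA A) t′∈ aE′∈ (λ z → if-diag (inA A z)) ∷ []

  e-partialDual : e Hᴬ ≡ eD (subData H A) ℕ.+ eD (subData H (complement A))
  e-partialDual = begin
    e Hᴬ
      ≡⟨ cong₂ ℕ._+_ (countOrbits-cong _ dual⊑ ⊑dual) (isoE-split H A) ⟩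
    countOrbits (λ _ → true) tE ℕ.+ (cᴬ ℕ.+ cᴬᶜ)
      ≡⟨ cong (ℕ._+ (cᴬ ℕ.+ cᴬᶜ)) (countOrbits-split (inA A) tE) ⟩
    edgesᴬ ℕ.+ edgesᴬᶜ ℕ.+ (cᴬ ℕ.+ cᴬᶜ)
      ≡⟨ rearrange edgesᴬ edgesᴬᶜ cᴬ cᴬᶜ ⟩
    eD (subData H A) ℕ.+ eD (subData H (complement A))
      ∎
    where
    open ≡-Reasoning
    tE : Gens (n H)
    tE = t H ∷ aE H ∷ []
    edgesᴬ edgesᴬᶜ : ℕ
    edgesᴬ  = countOrbits (inA A) tE
    edgesᴬᶜ = countOrbits (not ∘ inA A) tE
    dual⊑ : (t Hᴬ ∷ aE Hᴬ ∷ []) ⊑ tE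
    dual⊑ = agreesWith-if (inA A) (there (here refl)) (here refl) (λ _ → refl)
          ∷ agreesWith-if (inA A) (here refl) (there (here refl)) (λ _ → refl) ∷ []
    ⊑dual : tE ⊑ (t Hᴬ ∷ aE Hᴬ ∷ [])
    ⊑dual = agreesWith-if (inA A) (there (here refl)) (here refl) (λ z → if-diag (inA A z))
          ∷ agreesWith-if (inA A) (here refl) (there (here refl)) (λ z → if-diag (inA A z)) ∷ []
    rearrange : ∀ a b c d → a ℕ.+ b ℕ.+ (c ℕ.+ d) ≡ a ℕ.+ c ℕ.+ (b ℕ.+ d)
    rearrange = ℕ-Solver.solve-∀

  d-partialDual : d Hᴬ ≡ dD (subData H A) ℕ.+ dD (subData H (complement A))
  d-partialDual with count-involution-even (t H) (t-invol H) (t-fpf H) (inA A) (inA-t A)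
  ... | c , countᴬ≡c+c = begin
    ⌊ countTrue {n H} (λ _ → true) /2⌋
      ≡⟨ cong ⌊_/2⌋ (trans (countTrue≡count {n H} (λ _ → true)) (count-split (λ _ → true) (inA A))) ⟩
    ⌊ count (inA A) ℕ.+ count (not ∘ inA A) /2⌋
      ≡⟨ cong (λ x → ⌊ x ℕ.+ count (not ∘ inA A) /2⌋) countᴬ≡c+c ⟩
    ⌊ c ℕ.+ c ℕ.+ count (not ∘ inA A) /2⌋
      ≡⟨ ⌊double+n/2⌋ c _ ⟩
    c ℕ.+ ⌊ count (not ∘ inA A) /2⌋
      ≡⟨ cong₂ ℕ._+_ halfᴬ (cong ⌊_/2⌋ (countTrue≡count (not ∘ inA A))) ⟨
    ⌊ countTrue (inA A) /2⌋ ℕ.+ ⌊ countTrue (not ∘ inA A) /2⌋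
      ∎
    where
    open ≡-Reasoning
    halfᴬ : ⌊ countTrue (inA A) /2⌋ ≡ c
    halfᴬ = trans (cong ⌊_/2⌋ (trans (countTrue≡count (inA A)) countᴬ≡c+c)) (⌊double/2⌋ c)

εD≡ : ∀ D → εD D ≡ + 2 * + kD D + + dD D - (+ vD D + + eD D + + fD D)
εD≡ D = cong (λ z → z + + dD D - + (vD D ℕ.+ eD D ℕ.+ fD D)) (pos-* 2 (kD D))

εD-partialDual-identity : (D D′ Dᴬ Dᴬᶜ : HData) →
  vD D′ ℕ.+ HData.nIsoE Dᴬ ≡ fD Dᴬ → fD D′ ≡ fD Dᴬᶜ ℕ.+ HData.nIsoE Dᴬ →
  vD Dᴬ ≡ vD D → vD Dᴬᶜ ≡ vD D → kD D′ ≡ kD D →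
  eD D′ ≡ eD Dᴬ ℕ.+ eD Dᴬᶜ → dD D′ ≡ dD Dᴬ ℕ.+ dD Dᴬᶜ →
  εD D′ ≡ εD Dᴬ + εD Dᴬᶜ + + 2 * (+ kD D - + kD Dᴬ - + kD Dᴬᶜ) + + 2 * + vD D
εD-partialDual-identity D D′ Dᴬ Dᴬᶜ vᴰ fᴰ vᴬ vᴬᶜ kᴰ eᴰ dᴰ
  rewrite εD≡ D′ | εD≡ Dᴬ | εD≡ Dᴬᶜ | sym vᴰ | fᴰ | vᴬ | vᴬᶜ | kᴰ | eᴰ | dᴰ =
  ring (+ vD D′) (+ eD Dᴬ) (+ kD Dᴬ) (+ dD Dᴬ) (+ eD Dᴬᶜ) (+ fD Dᴬᶜ) (+ kD Dᴬᶜ) (+ dD Dᴬᶜ)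
       (+ vD D) (+ kD D) (+ HData.nIsoE Dᴬ)
  where
  ring : ∀ v′ eA kA dA eB fB kB dB v k c →
    + 2 * k + (dA + dB) - (v′ + (eA + eB) + (fB + c))
      ≡ (+ 2 * kA + dA - (v + eA + (v′ + c))) + (+ 2 * kB + dB - (v + eB + fB))
        + + 2 * (k - kA - kB) + + 2 * v
  ring = ℤ-Solver.solve-∀

corollary3p4 : (H : RibbonHypermap) (A : EdgeSubset H) →
    ε (partialDual H A)
    ≡ εSub H A + εSub H (complement A)
    + (+ 2) * (+ k H - + kSub H A - + kSub H (complement A))
    + (+ 2) * (+ v H)
corollary3p4 H A =
  εD-partialDual-identity (asData H) (asData (partialDual H A)) (subData H A) (subData H (complement A))
    (v-partialDual H A) (f-partialDual H A) (v-subData H A) (v-subData H (complement A))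
    (k-partialDual H A) (e-partialDual H A) (d-partialDual H A)
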